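{- For any positive integer $k$, there is a homomorphism of signed graphs $SPC(k+2)\to SPC(k)$.
   Context: A signed graph $(G,\sigma)$ is a graph $G$ with $\sigma:E(G)\to\{+,-\}$ (at most one edge of each sign between two vertices). Switching at a vertex set $X$ multiplies the signs of the edges with exactly one end in $X$ by $-1$. A homomorphism $(G,\sigma)\to(H,\pi)$ is a mapping of vertices to vertices and edges to edges preserving adjacencies, incidences and the signs of closed walks (the sign of a closed walk being the product of its edge signs, with multiplicity); equivalently, a signature $\sigma'$ obtained from $\sigma$ by switching together with a mapping preserving adjacencies, incidences and edge signs with respect to $\sigma'$ and $\pi$. The signed projective cube $SPC(k)$ is the signed Cayley graph on $\mathbb{Z}_2^k$ in which $x,y$ are joined by a positive edge iff $x-y\in\{e_1,\dots,e_k\}$ (standard basis) and by a negative edge iff $x-y=J$ (the all-ones vector). -}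

module Defs where

open import Data.Bool using (Bool; true; false; _xor_; if_then_else_)
open import Data.Nat using (ℕ)
open import Data.Fin using (Fin; _≟_)
open import Data.Vec using (Vec; zipWith; replicate; tabulate)
open import Data.Product using (Σ; ∃)
open import Relation.Binary.PropositionalEquality using (_≡_)
open import Relation.Nullary.Decidable using (⌊_⌋)

data Sign : Set where
  plus minus : Sign

flipSign : Sign → Sign
flipSign plus  = minus
flipSign minus = plus

-- A signed graph: a vertex type and, for each ordered pair of vertices and
-- each sign, the proposition that there is an edge of that sign joining them.
-- (At most one edge of each sign between two vertices, so an edge is
-- determined by its ends and its sign; the relation is meant to be symmetric.)
record SignedGraph : Set₁ where
  field
    V : Set
    E : V → V → Sign → Set
open SignedGraph public

switchSign : {V : Set} → (V → Bool) → V → V → Sign → Sign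
switchSign X u v s = if X u xor X v then flipSign s else s

-- Since edges are
-- determined by their ends and sign, the edge map is induced by f.
Hom : SignedGraph → SignedGraph → Set
Hom G H =
  Σ (V G → V H) λ f →
  Σ (V G → Bool) λ X →
  ∀ u v s → E G u v s → E H (f u) (f v) (switchSign X u v s)

-- Elements of Z_2^k as Boolean vectors; subtraction = addition = xor.
Z2^ : ℕ → Set
Z2^ k = Vec Bool k

_-ᶻ_ : ∀ {k} → Z2^ k → Z2^ k → Z2^ k
x -ᶻ y = zipWith _xor_ x y

basis : ∀ {k} → Fin k → Z2^ k
basis i = tabulate λ j → ⌊ i ≟ j ⌋

allOnes : ∀ {k} → Z2^ k
allOnes = replicate _ true

SPCEdge : (k : ℕ) → Z2^ k → Z2^ k → Sign → Set
SPCEdge k x y plus  = ∃ λ (i : Fin k) → x -ᶻ y ≡ basis i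
SPCEdge k x y minus = x -ᶻ y ≡ allOnes

SPC : ℕ → SignedGraph
SPC k = record { V = Z2^ k ; E = SPCEdge k }

-- The map collapse sends x ∈ ℤ₂^(k+2) to the first k coordinates of x, each
-- shifted by the parity c(x) of the last two coordinates, and one switches at
-- {x | c(x) = 1}.  Both maps are linear, so it suffices to follow the
-- generators of SPC(k+2): J keeps c = 0 and is sent to J; a basis vector e_i
-- with i < k keeps c = 0 and is sent to e_i; the two remaining basis vectors
-- have c = 1 and are sent to J with their positive sign switched to negative.
module Submission where

open import Defs
open import Algebra.Bundles using (CommutativeRing)
open import Data.Bool using (Bool; true; false; _xor_; if_then_else_)
open import Data.Bool.Properties using (xor-∧-commutativeRing)
open import Data.Fin using (Fin; zero; suc; _≟_; _↑ˡ_; _↑ʳ_; splitAt)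
open import Data.Fin.Properties
  using (splitAt-↑ˡ; splitAt-↑ʳ; splitAt⁻¹-↑ˡ; splitAt⁻¹-↑ʳ; ↑ˡ-injective; ↑ʳ-injective)
open import Data.Nat using (ℕ; _+_; _≤_)
open import Data.Product using (∃; _,_)
open import Data.Sum using (inj₁; inj₂)
open import Data.Vec using (lookup; tabulate)
open import Data.Vec.Properties using (lookup-zipWith; lookup∘tabulate; lookup-replicate)
open import Data.Vec.Relation.Binary.Pointwise.Extensional using (ext; Pointwise-≡⇒≡)
open import Function using (_∘_)
open import Relation.Nullary using (yes; no; contradiction)
open import Relation.Nullary.Decidable using (⌊_⌋; isYes≗does; dec-false)
open import Relation.Binary.PropositionalEquality
  using (_≡_; _≢_; refl; sym; trans; cong; cong₂; subst; module ≡-Reasoning)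

open import Algebra.Properties.CommutativeSemigroup
  (CommutativeRing.+-commutativeSemigroup xor-∧-commutativeRing)
  using (interchange)

private
  variable
    m n : ℕ

xor-interchange : ∀ a b c d → (a xor b) xor (c xor d) ≡ (a xor c) xor (b xor d)
xor-interchange = interchange

↑ˡ≢↑ʳ : (i : Fin m) (j : Fin n) → i ↑ˡ n ≢ m ↑ʳ j
↑ˡ≢↑ʳ {m} {n} i j eq with () ←
  trans (sym (splitAt-↑ˡ m i n)) (trans (cong (splitAt m) eq) (splitAt-↑ʳ m n j))

≟-↑ˡ : (i j : Fin m) → ⌊ i ↑ˡ n ≟ j ↑ˡ n ⌋ ≡ ⌊ i ≟ j ⌋
≟-↑ˡ {n = n} i j with i ↑ˡ n ≟ j ↑ˡ n | i ≟ j
... | yes _   | yes _   = refl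
... | no  _   | no  _   = refl
... | yes eq  | no  i≢j = contradiction (↑ˡ-injective n i j eq) i≢j
... | no  neq | yes i≡j = contradiction (cong (_↑ˡ n) i≡j) neq

≟-↑ʳ : (i j : Fin n) → ⌊ m ↑ʳ i ≟ m ↑ʳ j ⌋ ≡ ⌊ i ≟ j ⌋
≟-↑ʳ {m = m} i j with m ↑ʳ i ≟ m ↑ʳ j | i ≟ j
... | yes _   | yes _   = refl
... | no  _   | no  _   = refl
... | yes eq  | no  i≢j = contradiction (↑ʳ-injective m i j eq) i≢j
... | no  neq | yes i≡j = contradiction (cong (m ↑ʳ_) i≡j) neq

⌊≟⌋-≢ : {i j : Fin n} → i ≢ j → ⌊ i ≟ j ⌋ ≡ false
⌊≟⌋-≢ {i = i} {j} i≢j = trans (isYes≗does (i ≟ j)) (dec-false (i ≟ j) i≢j)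

lookup-basis : (i j : Fin n) → lookup (basis i) j ≡ ⌊ i ≟ j ⌋
lookup-basis i = lookup∘tabulate _

lookup-allOnes : (j : Fin n) → lookup allOnes j ≡ true
lookup-allOnes j = lookup-replicate j true

lookup--ᶻ : (x y : Z2^ n) (j : Fin n) → lookup (x -ᶻ y) j ≡ lookup x j xor lookup y j
lookup--ᶻ x y j = lookup-zipWith _xor_ j x y

-- The connection sets of SPC(n) as a signed Cayley graph, by sign.
SPCGenerator : Sign → Z2^ n → Set
SPCGenerator plus  d = ∃ λ i → d ≡ basis i
SPCGenerator minus d = d ≡ allOnes

SPCEdge⇒SPCGenerator : ∀ {x y : Z2^ n} s → SPCEdge n x y s → SPCGenerator s (x -ᶻ y)
SPCEdge⇒SPCGenerator plus  e = e
SPCEdge⇒SPCGenerator minus e = e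

SPCGenerator⇒SPCEdge : ∀ {x y : Z2^ n} s → SPCGenerator s (x -ᶻ y) → SPCEdge n x y s
SPCGenerator⇒SPCEdge plus  g = g
SPCGenerator⇒SPCEdge minus g = g

linear⇒Hom : (f : Z2^ m → Z2^ n) (X : Z2^ m → Bool) →
             (∀ x y → f x -ᶻ f y ≡ f (x -ᶻ y)) →
             (∀ x y → X x xor X y ≡ X (x -ᶻ y)) →
             (∀ s d → SPCGenerator s d → SPCGenerator (if X d then flipSign s else s) (f d)) →
             Hom (SPC m) (SPC n)
linear⇒Hom f X f-homo X-homo generator = f , X , edge
  where
  edge : ∀ x y s → SPCEdge _ x y s → SPCEdge _ (f x) (f y) (switchSign X x y s)
  edge x y s e rewrite X-homo x y =
    SPCGenerator⇒SPCEdge _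
      (subst (SPCGenerator _) (sym (f-homo x y))
        (generator s (x -ᶻ y) (SPCEdge⇒SPCGenerator s e)))

module _ (k : ℕ) where

  tailParity : Z2^ (k + 2) → Bool
  tailParity x = lookup x (k ↑ʳ zero) xor lookup x (k ↑ʳ suc zero)

  collapse : Z2^ (k + 2) → Z2^ k
  collapse x = tabulate λ j → tailParity x xor lookup x (j ↑ˡ 2)

  lookup-collapse : (x : Z2^ (k + 2)) (j : Fin k) →
                    lookup (collapse x) j ≡ tailParity x xor lookup x (j ↑ˡ 2)
  lookup-collapse x = lookup∘tabulate _

  tailParity-homo : ∀ x y → tailParity x xor tailParity y ≡ tailParity (x -ᶻ y)
  tailParity-homo x y = sym (begin
    tailParity (x -ᶻ y)
      ≡⟨ cong₂ _xor_ (lookup--ᶻ x y _) (lookup--ᶻ x y _) ⟩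
    (lookup x (k ↑ʳ zero) xor lookup y (k ↑ʳ zero)) xor
      (lookup x (k ↑ʳ suc zero) xor lookup y (k ↑ʳ suc zero))
      ≡⟨ xor-interchange (lookup x (k ↑ʳ zero)) _ (lookup x (k ↑ʳ suc zero)) _ ⟩
    tailParity x xor tailParity y ∎)
    where open ≡-Reasoning

  collapse-homo : ∀ x y → collapse x -ᶻ collapse y ≡ collapse (x -ᶻ y)
  collapse-homo x y = Pointwise-≡⇒≡ (ext λ j → begin
    lookup (collapse x -ᶻ collapse y) j
      ≡⟨ lookup--ᶻ (collapse x) (collapse y) j ⟩
    lookup (collapse x) j xor lookup (collapse y) j
      ≡⟨ cong₂ _xor_ (lookup-collapse x j) (lookup-collapse y j) ⟩
    (tailParity x xor lookup x (j ↑ˡ 2)) xor (tailParity y xor lookup y (j ↑ˡ 2))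
      ≡⟨ xor-interchange (tailParity x) (lookup x (j ↑ˡ 2)) (tailParity y) _ ⟩
    (tailParity x xor tailParity y) xor (lookup x (j ↑ˡ 2) xor lookup y (j ↑ˡ 2))
      ≡⟨ cong₂ _xor_ (tailParity-homo x y) (sym (lookup--ᶻ x y (j ↑ˡ 2))) ⟩
    tailParity (x -ᶻ y) xor lookup (x -ᶻ y) (j ↑ˡ 2)
      ≡⟨ lookup-collapse (x -ᶻ y) j ⟨
    lookup (collapse (x -ᶻ y)) j ∎)
    where open ≡-Reasoning

  tailParity-allOnes : tailParity allOnes ≡ false
  tailParity-allOnes =
    cong₂ _xor_ (lookup-allOnes (k ↑ʳ zero)) (lookup-allOnes (k ↑ʳ suc zero))

  tailParity-basis-↑ˡ : (i : Fin k) → tailParity (basis (i ↑ˡ 2)) ≡ false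
  tailParity-basis-↑ˡ i = cong₂ _xor_ (lookup-tail zero) (lookup-tail (suc zero))
    where
    lookup-tail : (m : Fin 2) → lookup (basis (i ↑ˡ 2)) (k ↑ʳ m) ≡ false
    lookup-tail m = trans (lookup-basis (i ↑ˡ 2) (k ↑ʳ m)) (⌊≟⌋-≢ (↑ˡ≢↑ʳ i m))

  tailParity-basis-↑ʳ : (m : Fin 2) → tailParity (basis (k ↑ʳ m)) ≡ true
  tailParity-basis-↑ʳ m = begin
    tailParity (basis (k ↑ʳ m))
      ≡⟨ cong₂ _xor_ (lookup-basis (k ↑ʳ m) (k ↑ʳ zero))
                     (lookup-basis (k ↑ʳ m) (k ↑ʳ suc zero)) ⟩
    ⌊ k ↑ʳ m ≟ k ↑ʳ zero ⌋ xor ⌊ k ↑ʳ m ≟ k ↑ʳ suc zero ⌋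
      ≡⟨ cong₂ _xor_ (≟-↑ʳ {m = k} m zero) (≟-↑ʳ {m = k} m (suc zero)) ⟩
    ⌊ m ≟ zero ⌋ xor ⌊ m ≟ suc zero ⌋
      ≡⟨ exactly-one m ⟩
    true ∎
    where
    open ≡-Reasoning
    exactly-one : (m : Fin 2) → ⌊ m ≟ zero ⌋ xor ⌊ m ≟ suc zero ⌋ ≡ true
    exactly-one zero       = refl
    exactly-one (suc zero) = refl

  collapse-allOnes : collapse allOnes ≡ allOnes
  collapse-allOnes = Pointwise-≡⇒≡ (ext λ j → begin
    lookup (collapse allOnes) j
      ≡⟨ lookup-collapse allOnes j ⟩
    tailParity allOnes xor lookup allOnes (j ↑ˡ 2)
      ≡⟨ cong₂ _xor_ tailParity-allOnes (lookup-allOnes (j ↑ˡ 2)) ⟩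
    true
      ≡⟨ lookup-allOnes j ⟨
    lookup allOnes j ∎)
    where open ≡-Reasoning

  collapse-basis-↑ˡ : (i : Fin k) → collapse (basis (i ↑ˡ 2)) ≡ basis i
  collapse-basis-↑ˡ i = Pointwise-≡⇒≡ (ext λ j → begin
    lookup (collapse (basis (i ↑ˡ 2))) j
      ≡⟨ lookup-collapse (basis (i ↑ˡ 2)) j ⟩
    tailParity (basis (i ↑ˡ 2)) xor lookup (basis (i ↑ˡ 2)) (j ↑ˡ 2)
      ≡⟨ cong₂ _xor_ (tailParity-basis-↑ˡ i) (lookup-basis (i ↑ˡ 2) (j ↑ˡ 2)) ⟩
    ⌊ i ↑ˡ 2 ≟ j ↑ˡ 2 ⌋
      ≡⟨ ≟-↑ˡ i j ⟩
    ⌊ i ≟ j ⌋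
      ≡⟨ lookup-basis i j ⟨
    lookup (basis i) j ∎)
    where open ≡-Reasoning

  collapse-basis-↑ʳ : (m : Fin 2) → collapse (basis (k ↑ʳ m)) ≡ allOnes
  collapse-basis-↑ʳ m = Pointwise-≡⇒≡ (ext λ j → begin
    lookup (collapse (basis (k ↑ʳ m))) j
      ≡⟨ lookup-collapse (basis (k ↑ʳ m)) j ⟩
    tailParity (basis (k ↑ʳ m)) xor lookup (basis (k ↑ʳ m)) (j ↑ˡ 2)
      ≡⟨ cong₂ _xor_ (tailParity-basis-↑ʳ m) (lookup-basis (k ↑ʳ m) (j ↑ˡ 2)) ⟩
    true xor ⌊ k ↑ʳ m ≟ j ↑ˡ 2 ⌋
      ≡⟨ cong (true xor_) (⌊≟⌋-≢ (↑ˡ≢↑ʳ j m ∘ sym)) ⟩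
    true
      ≡⟨ lookup-allOnes j ⟨
    lookup allOnes j ∎)
    where open ≡-Reasoning

  switch-by-tailParity : ∀ {s b} d → tailParity d ≡ b →
                         SPCGenerator (if b then flipSign s else s) (collapse d) →
                         SPCGenerator (if tailParity d then flipSign s else s) (collapse d)
  switch-by-tailParity {s} d eq =
    subst (λ b → SPCGenerator (if b then flipSign s else s) (collapse d)) (sym eq)

  collapse-SPCGenerator : ∀ s d → SPCGenerator s d →
                          SPCGenerator (if tailParity d then flipSign s else s) (collapse d)
  collapse-SPCGenerator minus d refl =
    switch-by-tailParity allOnes tailParity-allOnes collapse-allOnes
  collapse-SPCGenerator plus d (i , refl) with splitAt k i in eq
  ... | inj₁ i′ with refl ← splitAt⁻¹-↑ˡ eq =
    switch-by-tailParity (basis (i′ ↑ˡ 2)) (tailParity-basis-↑ˡ i′) (i′ , collapse-basis-↑ˡ i′)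
  ... | inj₂ m  with refl ← splitAt⁻¹-↑ʳ eq =
    switch-by-tailParity (basis (k ↑ʳ m)) (tailParity-basis-↑ʳ m) (collapse-basis-↑ʳ m)

mainTheorem5 : (k : ℕ) → 1 ≤ k → Hom (SPC (k + 2)) (SPC k)
mainTheorem5 k _ =
  linear⇒Hom (collapse k) (tailParity k)
    (collapse-homo k) (tailParity-homo k) (collapse-SPCGenerator k)
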